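{- For every connected multiset distance irregular graph $G$, $\dim_{ms}(G\boxtimes K_2)=|V(G)|$.
   Context: All graphs are finite, simple, undirected and connected; $K_2$ is the complete graph on two vertices. The strong product $G\boxtimes H$ has vertex set $V(G)\times V(H)$, with $(g,h)$ and $(g',h')$ adjacent iff ($g=g'$ and $hh'\in E(H)$) or ($gg'\in E(G)$ and $h=h'$) or ($gg'\in E(G)$ and $hh'\in E(H)$). For a connected graph $G$ with distance $d_G$, $u\in V(G)$ and $W=\{w_1,\dots,w_t\}\subseteq V(G)$, $\mathrm{m}_G(u|W)=\{\!\{d_G(u,w_1),\dots,d_G(u,w_t)\}\!\}$ (a multiset). $W$ is a multiset resolving set if the multisets $\mathrm{m}_G(u|W)$, $u\in V(G)$, are pairwise distinct; $\dim_{ms}(G)$ is the minimum cardinality of a multiset resolving set. $G$ is multiset distance irregular if $\mathrm{m}_G(x|V(G))\ne \mathrm{m}_G(y|V(G))$ for any two distinct vertices $x,y\in V(G)$. -}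

module Defs where

open import Data.Nat using (ℕ; zero; suc; _≤_)
open import Data.Bool using (Bool; true; false; _∧_; _∨_; if_then_else_; not)
open import Data.List using (List; []; _∷_; map; length; cartesianProduct)
open import Data.Bool.ListAction using (any)
open import Data.List.Membership.Propositional using (_∈_)
open import Data.List.Relation.Unary.Unique.Propositional using (Unique)
open import Data.List.Relation.Binary.Permutation.Propositional using (_↭_)
open import Data.Product using (_×_; _,_; proj₁; proj₂; ∃; Σ)
open import Relation.Binary.Definitions using (DecidableEquality)
open import Relation.Binary.PropositionalEquality using (_≡_)
open import Relation.Nullary.Decidable using (⌊_⌋)
open import Data.Product.Properties using (≡-dec)
import Data.Bool.Properties as BoolP

record Graph : Set₁ where
  field
    V     : Set
    _≟_   : DecidableEquality V
    verts : List V
    adj   : V → V → Bool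

open Graph public

record IsSimpleGraph (G : Graph) : Set where
  field
    complete : ∀ v → v ∈ verts G
    unique   : Unique (verts G)
    symmetric : ∀ u v → adj G u v ≡ adj G v u
    irreflexive : ∀ v → adj G v v ≡ false

data Walk (G : Graph) : V G → V G → ℕ → Set where
  here : ∀ {u} → Walk G u u zero
  step : ∀ {u w v k} → adj G u w ≡ true → Walk G w v k → Walk G u v (suc k)

Connected : Graph → Set
Connected G = ∀ u v → ∃ λ k → Walk G u v k

order : Graph → ℕ
order G = length (verts G)

reach : (G : Graph) → ℕ → V G → V G → Bool
reach G zero    u v = ⌊ (_≟_ G) u v ⌋
reach G (suc k) u v = any (λ w → adj G u w ∧ reach G k w v) (verts G)

-- least i in [start, start+fuel) with p i, or start+fuel if none
findLeast : ℕ → ℕ → (ℕ → Bool) → ℕ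
findLeast start zero     p = start
findLeast start (suc f)  p = if p start then start else findLeast (suc start) f p

-- graph distance d_G(u,v): the least length of a walk from u to v
-- (searched among 0 .. |V(G)|-1, which suffices for connected graphs)
dist : (G : Graph) → V G → V G → ℕ
dist G u v = findLeast 0 (order G) (λ k → reach G k u v)

-- m_G(u | W) as a list; multisets are compared up to permutation (_↭_)
mset : (G : Graph) → V G → List (V G) → List ℕ
mset G u W = map (dist G u) W

-- W is a multiset resolving set (W is a set of vertices: a duplicate-free list)
IsMultisetResolving : (G : Graph) → List (V G) → Set
IsMultisetResolving G W =
  Unique W × (∀ u v → mset G u W ↭ mset G v W → u ≡ v)

DimMs : (G : Graph) → ℕ → Set
DimMs G m =
  (Σ (List (V G)) λ W → IsMultisetResolving G W × length W ≡ m) ×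
  (∀ W → IsMultisetResolving G W → m ≤ length W)

MultisetDistanceIrregular : Graph → Set
MultisetDistanceIrregular G =
  ∀ x y → mset G x (verts G) ↭ mset G y (verts G) → x ≡ y

K₂ : Graph
K₂ = record
  { V = Bool
  ; _≟_ = BoolP._≟_
  ; verts = true ∷ false ∷ []
  ; adj = λ a b → not ⌊ BoolP._≟_ a b ⌋
  }

_⊠_ : Graph → Graph → Graph
G ⊠ H = record
  { V = V G × V H
  ; _≟_ = ≡-dec (_≟_ G) (_≟_ H)
  ; verts = cartesianProduct (verts G) (verts H)
  ; adj = λ { (g , h) (g' , h') →
        (⌊ (_≟_ G) g g' ⌋ ∧ adj H h h')
      ∨ (adj G g g' ∧ ⌊ (_≟_ H) h h' ⌋)
      ∨ (adj G g g' ∧ adj H h h') }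
  }

-- In G ⊠ K₂ the distance from (x , b) to (y , c) is d_G(x , y) when x ≠ y, and the two copies of x
-- are at distance 1. So (x , true) and (x , false) are twins, and a multiset resolving set must
-- contain a copy of every vertex of G, giving the lower bound |V(G)|. Conversely the copy
-- V(G) × {true} resolves: seen from it, (x , true) has the multiset m_G(x | V(G)) and (x , false) the
-- same multiset with its only 0 replaced by 1. The presence of a 0 tells the two layers apart, and
-- within a layer multiset distance irregularity of G separates the vertices.
module Submission where

open import Defs
open import Data.Bool using (true; false; T)
open import Data.Bool.Properties using (T-∧; T-≡; ∨-zeroʳ) renaming (_≟_ to _≟ᴮ_)
open import Data.Nat using (zero; suc; _+_; _*_; _≤_; _<_; z≤n; s≤s) renaming (_≟_ to _≟ℕ_)
open import Data.Nat.Properties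
  using (≤-antisym; ≤-<-trans; <-≤-trans; ≤∧≢⇒<; ≮⇒≥; ≤⇒≯; <-irrefl; +-identityʳ; +-suc;
         m≤n⇒m≤1+n; n≤0⇒n≡0; m≤m*n; module ≤-Reasoning)
open import Data.List using (List; []; _∷_; map; length; _++_; cartesianProduct)
open import Data.List.Properties using (length-map; length-++; length-removeAt′; map-∘; map-cong-local)
open import Data.List.Relation.Unary.Any using (here; there; index; satisfied; _─_)
open import Data.List.Relation.Unary.Any.Properties using (any⁺; any⁻)
open import Data.List.Relation.Unary.All as All using (All)
open import Data.List.Relation.Unary.All.Properties using (¬Any⇒All¬)
open import Data.List.Relation.Unary.Unique.Propositional using (Unique; []; _∷_)
import Data.List.Relation.Unary.Unique.Propositional.Properties as Unique
open import Data.List.Membership.Propositional using (_∈_; _∉_; lose)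
open import Data.List.Membership.Propositional.Properties using (∈-map⁺; ∈-map⁻; ∈-cartesianProduct⁺)
import Data.List.Membership.DecPropositional as DecMembership
open import Data.List.Relation.Binary.Subset.Propositional using (_⊆_)
open import Data.List.Relation.Binary.Permutation.Propositional
  using (_↭_; prep; swap; ↭-refl; ↭-sym; ↭-reflexive; module PermutationReasoning)
open import Data.List.Relation.Binary.Permutation.Propositional.Properties using (drop-∷; ∈-resp-↭)
open import Data.Product using (_×_; _,_; proj₁; proj₂; ∃; Σ)
open import Data.Sum using (_⊎_; inj₁; inj₂)
open import Data.Empty using (⊥-elim)
open import Function using (_∘_)
open import Function.Bundles using (Equivalence)
open import Relation.Nullary using (¬_; yes; no; contradiction)
open import Relation.Nullary.Decidable using (⌊_⌋; toWitness; fromWitness)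
open import Relation.Binary.PropositionalEquality
  using (_≡_; _≢_; refl; sym; trans; cong; cong₂; subst; subst₂; module ≡-Reasoning)

open Equivalence using (to; from)

module _ {A : Set} where

  ∈-─ : ∀ {x y : A} {xs} (x∈xs : x ∈ xs) → y ∈ xs → x ≢ y → y ∈ (xs ─ x∈xs)
  ∈-─ (here refl) (here refl)  x≢y = contradiction refl x≢y
  ∈-─ (here refl) (there y∈xs) _   = y∈xs
  ∈-─ (there _)   (here refl)  _   = here refl
  ∈-─ (there x∈xs) (there y∈xs) x≢y = there (∈-─ x∈xs y∈xs x≢y)

  Unique-⊆⇒length≤ : ∀ {xs ys : List A} → Unique xs → xs ⊆ ys → length xs ≤ length ys
  Unique-⊆⇒length≤ {[]}     _                 _      = z≤n
  Unique-⊆⇒length≤ {x ∷ xs} {ys} (x∉xs ∷ uniq) xs⊆ys = begin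
    suc (length xs)           ≤⟨ s≤s (Unique-⊆⇒length≤ uniq xs⊆ys─x) ⟩
    suc (length (ys ─ x∈ys))  ≡⟨ length-removeAt′ ys (index x∈ys) ⟨
    length ys                 ∎
    where
    open ≤-Reasoning
    x∈ys : x ∈ ys
    x∈ys = xs⊆ys (here refl)
    xs⊆ys─x : xs ⊆ (ys ─ x∈ys)
    xs⊆ys─x y∈xs = ∈-─ x∈ys (xs⊆ys (there y∈xs)) (All.lookup x∉xs y∈xs)

  distinct⇒1<length : ∀ {x y : A} {xs} → x ∈ xs → y ∈ xs → x ≢ y → 1 < length xs
  distinct⇒1<length {xs = _ ∷ _ ∷ _} _           _           _   = s≤s (s≤s z≤n)
  distinct⇒1<length {xs = _ ∷ []}    (here refl) (here refl) x≢y = contradiction refl x≢y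

  ∷-map-↭-at : ∀ {B : Set} {f g : A → B} {x xs} → Unique xs → x ∈ xs →
               (∀ {y} → x ≢ y → f y ≡ g y) → f x ∷ map g xs ↭ g x ∷ map f xs
  ∷-map-↭-at {f = f} {g} {x} (x∉ys ∷ _) (here refl) f≗g =
    swap (f x) (g x) (↭-reflexive (sym (map-cong-local (All.map f≗g x∉ys))))
  ∷-map-↭-at {f = f} {g} {x} {y ∷ ys} (y∉ys ∷ uniq) (there x∈ys) f≗g = begin
    f x ∷ g y ∷ map g ys  ↭⟨ swap _ _ ↭-refl ⟩
    g y ∷ f x ∷ map g ys  ↭⟨ prep _ (∷-map-↭-at uniq x∈ys f≗g) ⟩
    g y ∷ g x ∷ map f ys  ↭⟨ swap _ _ ↭-refl ⟩
    g x ∷ g y ∷ map f ys  ≡⟨ cong (λ z → g x ∷ z ∷ map f ys) (f≗g x≢y) ⟨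
    g x ∷ f y ∷ map f ys  ∎
    where
    open PermutationReasoning
    x≢y : x ≢ y
    x≢y x≡y = All.lookup y∉ys x∈ys (sym x≡y)

length-cartesianProduct : ∀ {A B : Set} (xs : List A) (ys : List B) →
                          length (cartesianProduct xs ys) ≡ length xs * length ys
length-cartesianProduct []       ys = refl
length-cartesianProduct (x ∷ xs) ys = begin
  length (map (x ,_) ys ++ cartesianProduct xs ys)        ≡⟨ length-++ (map (x ,_) ys) ⟩
  length (map (x ,_) ys) + length (cartesianProduct xs ys)
    ≡⟨ cong₂ _+_ (length-map (x ,_) ys) (length-cartesianProduct xs ys) ⟩
  length ys + length xs * length ys                      ∎
  where open ≡-Reasoning

findLeast-minimal : ∀ s f p {j} → s ≤ j → j < findLeast s f p → ¬ T (p j)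
findLeast-minimal s zero    p s≤j j<s = ⊥-elim (≤⇒≯ s≤j j<s)
findLeast-minimal s (suc f) p {j} s≤j j<r with p s in ps
... | true = ⊥-elim (≤⇒≯ s≤j j<r)
... | false with s ≟ℕ j
...   | yes refl = subst T ps
...   | no s≢j   = findLeast-minimal (suc s) f p (≤∧≢⇒< s≤j s≢j) j<r

findLeast-found : ∀ s f p → findLeast s f p < s + f → T (p (findLeast s f p))
findLeast-found s zero    p s<s+0 = ⊥-elim (<-irrefl (sym (+-identityʳ s)) s<s+0)
findLeast-found s (suc f) p r<    with p s in ps
... | true  = subst T (sym ps) _
... | false = findLeast-found (suc s) f p (subst (findLeast (suc s) f p <_) (+-suc s f) r<)

findLeast-≤ : ∀ s f p {k} → s ≤ k → T (p k) → findLeast s f p ≤ k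
findLeast-≤ s f p s≤k pk = ≮⇒≥ (λ k<r → findLeast-minimal s f p s≤k k<r pk)

module _ (H : Graph) (complete : ∀ v → v ∈ verts H) where

  reach⇒Walk : ∀ k {u v} → T (reach H k u v) → Walk H u v k
  reach⇒Walk zero    t with refl ← toWitness t = here
  reach⇒Walk (suc k) t with w , t′ ← satisfied (any⁻ _ (verts H) t) =
    step (to T-≡ (proj₁ (to T-∧ t′))) (reach⇒Walk k (proj₂ (to T-∧ t′)))

  Walk⇒reach : ∀ {k u v} → Walk H u v k → T (reach H k u v)
  Walk⇒reach here = fromWitness refl
  Walk⇒reach (step {w = w} uw r) =
    any⁺ _ (lose (complete w) (from T-∧ (from T-≡ uw , Walk⇒reach r)))

  dist-minimal : ∀ {u v j} → j < dist H u v → ¬ Walk H u v j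
  dist-minimal j<d r = findLeast-minimal 0 (order H) _ z≤n j<d (Walk⇒reach r)

  dist-≤ : ∀ {u v k} → Walk H u v k → dist H u v ≤ k
  dist-≤ r = findLeast-≤ 0 (order H) _ z≤n (Walk⇒reach r)

  -- dist only searches lengths below |V(H)|, so a witness in that range is needed.
  dist-attained : ∀ {u v k} → Walk H u v k → k < order H → Walk H u v (dist H u v)
  dist-attained r k<n = reach⇒Walk _ (findLeast-found 0 (order H) _ (≤-<-trans (dist-≤ r) k<n))

  shortest⇒dist : ∀ {u v d} → Walk H u v d → d < order H →
                  (∀ {j} → j < d → ¬ Walk H u v j) → dist H u v ≡ d
  shortest⇒dist r d<n shortest =
    ≤-antisym (dist-≤ r) (≮⇒≥ (λ δ<d → shortest δ<d (dist-attained r d<n)))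

  dist-refl : ∀ {u} → dist H u u ≡ 0
  dist-refl = n≤0⇒n≡0 (dist-≤ here)

  adjacent⇒dist≡1 : ∀ {u v} → adj H u v ≡ true → u ≢ v → dist H u v ≡ 1
  adjacent⇒dist≡1 {u} {v} uv u≢v =
    shortest⇒dist (step uv here) (distinct⇒1<length (complete u) (complete v) u≢v) no-loop
    where
    no-loop : ∀ {j} → j < 1 → ¬ Walk H u v j
    no-loop (s≤s z≤n) here = u≢v refl

vertices : ∀ {H u v k} → Walk H u v k → List (V H)
vertices {u = u} here       = u ∷ []
vertices {u = u} (step _ r) = u ∷ vertices r

length-vertices : ∀ {H u v k} (r : Walk H u v k) → length (vertices r) ≡ suc k
length-vertices here       = refl
length-vertices (step _ r) = cong suc (length-vertices r)

Path : (H : Graph) → V H → V H → Set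
Path H u v = ∃ λ k → Σ (Walk H u v k) (Unique ∘ vertices)

suffix-path : ∀ {H x u v k} (r : Walk H u v k) → Unique (vertices r) → x ∈ vertices r → Path H x v
suffix-path here         uniq       (here refl)  = _ , here , uniq
suffix-path r@(step _ _) uniq       (here refl)  = _ , r , uniq
suffix-path (step _ r)   (_ ∷ uniq) (there x∈r) = suffix-path r uniq x∈r

-- Prepend the edges one at a time, cutting the loop whenever the new start is revisited.
walk⇒path : ∀ {H u v k} → Walk H u v k → Path H u v
walk⇒path here = _ , here , All.[] ∷ []
walk⇒path {H} {u} (step uw r) with walk⇒path r
... | _ , p , uniq with DecMembership._∈?_ (_≟_ H) u (vertices p)
...   | yes u∈p = suffix-path p uniq u∈p
...   | no  u∉p = _ , step uw p , ¬Any⇒All¬ _ u∉p ∷ uniq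

module _ (H : Graph) (simple : IsSimpleGraph H) (connected : Connected H) where
  open IsSimpleGraph simple

  walk-within-order : ∀ u v → ∃ λ k → k < order H × Walk H u v k
  walk-within-order u v with _ , p , uniq ← walk⇒path (proj₂ (connected u v)) =
    _ , subst (_≤ order H) (length-vertices p) (Unique-⊆⇒length≤ uniq (λ _ → complete _)) , p

  dist<order : ∀ {u v} → dist H u v < order H
  dist<order {u} {v} with _ , k<n , r ← walk-within-order u v = ≤-<-trans (dist-≤ H complete r) k<n

  dist-walk : ∀ {u v} → Walk H u v (dist H u v)
  dist-walk {u} {v} with _ , k<n , r ← walk-within-order u v = dist-attained H complete r k<n

  dist≡0⇒≡ : ∀ {u v} → dist H u v ≡ 0 → u ≡ v
  dist≡0⇒≡ d≡0 with here ← subst (Walk H _ _) d≡0 dist-walk = refl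

module StrongProduct (G H : Graph) where

  ⊠-adj⁻ : ∀ {x b y c} → adj (G ⊠ H) (x , b) (y , c) ≡ true → x ≡ y ⊎ adj G x y ≡ true
  ⊠-adj⁻ {x} {y = y} _ with (_≟_ G) x y | adj G x y
  ... | yes x≡y | _    = inj₁ x≡y
  ... | no _    | true = inj₂ refl

  ⊠-adj-layer : ∀ {x y b} → adj G x y ≡ true → adj (G ⊠ H) (x , b) (y , b) ≡ true
  ⊠-adj-layer {b = b} xy with (_≟_ H) b b
  ... | yes _ rewrite xy = ∨-zeroʳ _
  ... | no b≢b = contradiction refl b≢b

  ⊠-adj-diagonal : ∀ {x y b c} → adj G x y ≡ true → adj H b c ≡ true →
                   adj (G ⊠ H) (x , b) (y , c) ≡ true
  ⊠-adj-diagonal {b = b} {c} xy bc rewrite xy | bc | ∨-zeroʳ ⌊ (_≟_ H) b c ⌋ = ∨-zeroʳ _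

  ⊠-adj-fibre : ∀ {x b c} → adj H b c ≡ true → adj (G ⊠ H) (x , b) (x , c) ≡ true
  ⊠-adj-fibre {x} bc with (_≟_ G) x x
  ... | yes _ rewrite bc = refl
  ... | no x≢x = contradiction refl x≢x

  ⊠-walk-layer : ∀ {x y b k} → Walk G x y k → Walk (G ⊠ H) (x , b) (y , b) k
  ⊠-walk-layer here        = here
  ⊠-walk-layer (step xw r) = step (⊠-adj-layer xw) (⊠-walk-layer r)

  ⊠-walk-proj₁ : ∀ {x b y c k} → Walk (G ⊠ H) (x , b) (y , c) k →
                 ∃ λ k′ → k′ ≤ k × Walk G x y k′
  ⊠-walk-proj₁ here = 0 , z≤n , here
  ⊠-walk-proj₁ (step {w = _ , _} xw r) with ⊠-adj⁻ xw | ⊠-walk-proj₁ r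
  ... | inj₁ refl | k′ , k′≤k , r′ = k′ , m≤n⇒m≤1+n k′≤k , r′
  ... | inj₂ xw′  | k′ , k′≤k , r′ = suc k′ , s≤s k′≤k , step xw′ r′

  ⊠-complete : (∀ x → x ∈ verts G) → (∀ b → b ∈ verts H) → ∀ v → v ∈ verts (G ⊠ H)
  ⊠-complete completeG completeH (x , b) = ∈-cartesianProduct⁺ (completeG x) (completeH b)

K₂-complete : ∀ b → b ∈ verts K₂
K₂-complete true  = here refl
K₂-complete false = there (here refl)

K₂-adj : ∀ {b c} → b ≢ c → adj K₂ b c ≡ true
K₂-adj {true}  {true}  b≢c = contradiction refl b≢c
K₂-adj {true}  {false} _   = refl
K₂-adj {false} {true}  _   = refl
K₂-adj {false} {false} b≢c = contradiction refl b≢c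

module _ (G : Graph) (simple : IsSimpleGraph G) (connected : Connected G) where
  open IsSimpleGraph simple
  open StrongProduct G K₂

  private
    P : Graph
    P = G ⊠ K₂

    completeP : ∀ v → v ∈ verts P
    completeP = ⊠-complete complete K₂-complete

  ⊠K₂-walk-lift : ∀ {x y b c k} → x ≢ y → Walk G x y k → Walk P (x , b) (y , c) k
  ⊠K₂-walk-lift         x≢x here = contradiction refl x≢x
  ⊠K₂-walk-lift {b = b} {c} _ (step xw r) with b ≟ᴮ c
  ... | yes refl = step (⊠-adj-layer xw) (⊠-walk-layer r)
  ... | no b≢c   = step (⊠-adj-diagonal xw (K₂-adj b≢c)) (⊠-walk-layer r)

  order-⊠K₂ : order G ≤ order P
  order-⊠K₂ = subst (order G ≤_) (sym (length-cartesianProduct (verts G) (verts K₂))) (m≤m*n (order G) 2)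

  dist-⊠K₂-≢ : ∀ {x y b c} → x ≢ y → dist P (x , b) (y , c) ≡ dist G x y
  dist-⊠K₂-≢ x≢y =
    shortest⇒dist P completeP (⊠K₂-walk-lift x≢y (dist-walk G simple connected))
      (<-≤-trans (dist<order G simple connected) order-⊠K₂) shorter
    where
    shorter : ∀ {j} → j < _ → ¬ Walk P _ _ j
    shorter j<d r with _ , j′≤j , r′ ← ⊠-walk-proj₁ r =
      dist-minimal G complete (≤-<-trans j′≤j j<d) r′

  dist-⊠K₂-fibre : ∀ {x b c} → b ≢ c → dist P (x , b) (x , c) ≡ 1
  dist-⊠K₂-fibre b≢c =
    adjacent⇒dist≡1 P completeP (⊠-adj-fibre (K₂-adj b≢c)) (λ { refl → b≢c refl })

  dist-⊠K₂-layer : ∀ {x y b} → dist P (x , b) (y , b) ≡ dist G x y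
  dist-⊠K₂-layer {x} {y} with (_≟_ G) x y
  ... | yes refl = trans (dist-refl P completeP) (sym (dist-refl G complete))
  ... | no x≢y   = dist-⊠K₂-≢ x≢y

  dist-⊠K₂≡0⇒≡ : ∀ {u v} → dist P u v ≡ 0 → u ≡ v
  dist-⊠K₂≡0⇒≡ {x , b} {y , c} d≡0 with (_≟_ G) x y | b ≟ᴮ c
  ... | no x≢y   | _        =
    contradiction (dist≡0⇒≡ G simple connected (trans (sym (dist-⊠K₂-≢ x≢y)) d≡0)) x≢y
  ... | yes refl | yes refl = refl
  ... | yes refl | no b≢c   = contradiction (trans (sym (dist-⊠K₂-fibre b≢c)) d≡0) λ ()

  layer : List (V P)
  layer = map (_, true) (verts G)

  mset-layer-true : ∀ x → mset P (x , true) layer ≡ mset G x (verts G)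
  mset-layer-true x = trans (sym (map-∘ (verts G))) (map-cong-local (All.tabulate (λ _ → dist-⊠K₂-layer)))

  -- That is, mset P (x , false) layer is m_G(x | V(G)) with the entry 0 of x itself replaced by 1.
  mset-layer-false : ∀ x → 0 ∷ mset P (x , false) layer ↭ 1 ∷ mset G x (verts G)
  mset-layer-false x = begin
    0 ∷ mset P (x , false) layer           ≡⟨ cong (_∷ mset P (x , false) layer) (dist-refl G complete) ⟨
    dist G x x ∷ mset P (x , false) layer  ≡⟨ cong (dist G x x ∷_) (map-∘ (verts G)) ⟨
    dist G x x ∷ map (λ y → dist P (x , false) (y , true)) (verts G)
      ↭⟨ ∷-map-↭-at unique (complete x) (λ x≢y → sym (dist-⊠K₂-≢ x≢y)) ⟩
    dist P (x , false) (x , true) ∷ mset G x (verts G)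
      ≡⟨ cong (_∷ mset G x (verts G)) (dist-⊠K₂-fibre (λ ())) ⟩
    1 ∷ mset G x (verts G)                 ∎
    where open PermutationReasoning

  0∈mset-layer-true : ∀ x → 0 ∈ mset P (x , true) layer
  0∈mset-layer-true x = subst (0 ∈_) (sym (mset-layer-true x))
    (subst (_∈ mset G x (verts G)) (dist-refl G complete) (∈-map⁺ (dist G x) (complete x)))

  0∉mset-layer-false : ∀ x → 0 ∉ mset P (x , false) layer
  0∉mset-layer-false x 0∈ with ∈-map⁻ (dist P (x , false)) 0∈
  ... | _ , y∈ , 0≡d with ∈-map⁻ (_, true) y∈
  ...   | _ , _ , refl with () ← dist-⊠K₂≡0⇒≡ (sym 0≡d)

  layer-resolving : MultisetDistanceIrregular G → IsMultisetResolving P layer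
  layer-resolving irregular = Unique.map⁺ (cong proj₁) unique , resolves
    where
    resolves : ∀ u v → mset P u layer ↭ mset P v layer → u ≡ v
    resolves (x , true) (y , true) m =
      cong (_, true) (irregular x y (subst₂ _↭_ (mset-layer-true x) (mset-layer-true y) m))
    resolves (x , false) (y , false) m = cong (_, false) (irregular x y (drop-∷ (begin
      1 ∷ mset G x (verts G)        ↭⟨ mset-layer-false x ⟨
      0 ∷ mset P (x , false) layer  ↭⟨ prep 0 m ⟩
      0 ∷ mset P (y , false) layer  ↭⟨ mset-layer-false y ⟩
      1 ∷ mset G y (verts G)        ∎)))
      where open PermutationReasoning
    resolves (x , true)  (y , false) m =
      ⊥-elim (0∉mset-layer-false y (∈-resp-↭ m (0∈mset-layer-true x)))
    resolves (x , false) (y , true)  m =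
      ⊥-elim (0∉mset-layer-false x (∈-resp-↭ (↭-sym m) (0∈mset-layer-true y)))

  -- (x , true) and (x , false) are twins, so a resolving set cannot miss both.
  resolving⇒meets-fibre : ∀ {W} → IsMultisetResolving P W → ∀ x → ∃ λ c → (x , c) ∈ W
  resolving⇒meets-fibre {W} (_ , resolves) x
    with DecMembership._∈?_ (_≟_ P) (x , true) W | DecMembership._∈?_ (_≟_ P) (x , false) W
  ... | yes t∈ | _      = true , t∈
  ... | no _   | yes f∈ = false , f∈
  ... | no t∉  | no f∉  =
    contradiction (resolves _ _ (↭-reflexive (map-cong-local (All.tabulate twins)))) λ ()
    where
    twins : ∀ {w} → w ∈ W → dist P (x , true) w ≡ dist P (x , false) w
    twins {y , c} w∈ with (_≟_ G) x y
    ... | no x≢y = trans (dist-⊠K₂-≢ x≢y) (sym (dist-⊠K₂-≢ x≢y))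
    twins {_ , true}  w∈ | yes refl = contradiction w∈ t∉
    twins {_ , false} w∈ | yes refl = contradiction w∈ f∉

  resolving⇒order≤ : ∀ W → IsMultisetResolving P W → order G ≤ length W
  resolving⇒order≤ W resolving = begin
    order G                        ≡⟨ length-map section (verts G) ⟨
    length (map section (verts G))
      ≤⟨ Unique-⊆⇒length≤ (Unique.map⁺ (cong proj₁) unique) section⊆W ⟩
    length W                       ∎
    where
    open ≤-Reasoning
    section : V G → V P
    section x = x , proj₁ (resolving⇒meets-fibre resolving x)
    section⊆W : map section (verts G) ⊆ W
    section⊆W s∈ with x , _ , refl ← ∈-map⁻ section s∈ = proj₂ (resolving⇒meets-fibre resolving x)

corollary8 : (G : Graph) → IsSimpleGraph G → Connected G →
    MultisetDistanceIrregular G → DimMs (G ⊠ K₂) (order G)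
corollary8 G simple connected irregular =
  (layer G simple connected , layer-resolving G simple connected irregular , length-map _ (verts G)) ,
  resolving⇒order≤ G simple connected
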